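{- Let $n\ge 6$ and let $u$ be a sequence on $n$ distinct letters such that every letter occurs at least twice, $fw(u)=4$, $u$ has alternation length $5$, and the first $n$ letters of $u$ are $1\,2\ldots n$. If the last letter of $u$ is $1$, the middle letter of $u$ is $2$, and the second-to-last letter of $u$ is $2$, then $u=1\,2\ldots n\;2\,3\ldots n\;2\;1$.
   Context: A sequence $s$ contains $u$ if some (not necessarily contiguous) subsequence of $s$ can be changed into $u$ by a one-to-one renaming of letters. An $(r,s)$-formation is a concatenation of $s$ permutations, each of the same set of $r$ distinct letters. The formation width $fw(u)$ is the minimum $s$ such that there exists $r$ for which every $(r,s)$-formation contains $u$. A sequence has alternation length $5$ if it contains $ababa$ (for distinct letters $a,b$) but does not contain $ababab$. Every sequence satisfying the hypotheses has length $2n+1$; its middle letter is its $(n+1)$-st letter. -}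

module Defs where

open import Data.Nat using (ℕ; zero; suc; _+_; _∸_; _≤_; _<_)
open import Data.Nat.Properties using (_≟_)
open import Data.List using (List; []; _∷_; _++_; map; concat; length; filter; upTo; take; drop; deduplicate)
open import Data.List.Membership.Propositional using (_∈_)
open import Data.List.Relation.Unary.All using (All)
open import Data.List.Relation.Unary.Unique.Propositional using (Unique)
open import Data.List.Relation.Binary.Permutation.Propositional using (_↭_)
open import Data.List.Relation.Binary.Sublist.Propositional using (_⊆_)
open import Data.Product using (Σ; ∃; _×_; _,_)
open import Relation.Binary.PropositionalEquality using (_≡_)
open import Relation.Nullary using (¬_)

Seq : Set
Seq = List ℕ

Contains : Seq → Seq → Set
Contains s u = Σ Seq λ w → (w ⊆ s) × Σ (ℕ → ℕ) λ f →
  (∀ {x y} → x ∈ w → y ∈ w → f x ≡ f y → x ≡ y) × (map f w ≡ u)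

IsFormation : ℕ → ℕ → Seq → Set
IsFormation r s x = Σ Seq λ L → Unique L × (length L ≡ r) ×
  Σ (List Seq) λ ps → (length ps ≡ s) × All (λ p → p ↭ L) ps × (concat ps ≡ x)

FWWitness : Seq → ℕ → Set
FWWitness u s = ∃ λ r → ∀ x → IsFormation r s x → Contains x u

FW≡ : Seq → ℕ → Set
FW≡ u k = FWWitness u k × (∀ s → s < k → ¬ FWWitness u s)

numLetters : Seq → ℕ
numLetters u = length (deduplicate _≟_ u)

occ : ℕ → Seq → ℕ
occ x u = length (filter (_≟ x) u)

-- alternation length 5: contains ababa but not ababab (a ≠ b enforced by injectivity)
AltLength5 : Seq → Set
AltLength5 u = Contains u (0 ∷ 1 ∷ 0 ∷ 1 ∷ 0 ∷ [])
             × ¬ Contains u (0 ∷ 1 ∷ 0 ∷ 1 ∷ 0 ∷ 1 ∷ [])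

-- the list a, a+1, ..., b  (empty if b < a)
range : ℕ → ℕ → Seq
range a b = map (a +_) (upTo (suc b ∸ a))

-- middle letter of u (a sequence of length 2n+1) is its (n+1)-st letter
MiddleIs : ℕ → Seq → ℕ → Set
MiddleIs n u c = Σ Seq λ v → drop n u ≡ c ∷ v

-- Only two consequences of fw(u) = 4 are used: u occurs in the formation of four ascending
-- blocks 0 1 … r-1, and in the one whose third block is descending instead. Write
-- u = 1 … n 2 m 2 1. In a formation a repeated letter moves to a strictly later block, so a
-- frame a b … b a confines the b's to three consecutive blocks; this excludes abbbba, abbccba
-- and abdcbcdba from the ascending formation and abbaba from the other one. Reading these
-- patterns in u shows that m avoids 1 and 2, has no repeated letter, and lists any two of its
-- letters in the order of the prefix. Since every letter occurs twice, the letters of m are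
-- exactly 3 … n, hence m = 3 … n.

module Submission where

open import Defs
open import Data.Empty using (⊥; ⊥-elim)
open import Data.Nat using (ℕ; suc; _+_; _∸_; _≤_; _<_; _≟_; z≤n; s≤s; s≤s⁻¹; z<s)
open import Data.Nat.Properties
open import Data.List using (List; []; _∷_; _++_; map; concat; length; filter; take; upTo; downFrom)
open import Data.List.Properties
  using ( ∷-injectiveʳ; filter-++; filter-none; filter-accept; filter-reject; length-++
        ; map-∘; map-id; map-id-local; map-++; take++drop≡id; length-upTo; reverse-upTo )
open import Data.List.Membership.Propositional using (_∈_; _∉_)
open import Data.List.Membership.Propositional.Properties
  using (∈-map⁺; ∈-map⁻; ∈-upTo⁺; ∈-upTo⁻; ∈-++⁺ˡ; ∈-++⁺ʳ; ∈-++⁻)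
open import Data.List.Relation.Unary.Any using (here; there)
open import Data.List.Relation.Unary.All as All using (All; []; _∷_)
open import Data.List.Relation.Unary.AllPairs as AllPairs using (AllPairs; []; _∷_)
import Data.List.Relation.Unary.AllPairs.Properties as AllPairs
import Data.List.Relation.Unary.All.Properties as All
open import Data.List.Relation.Unary.Unique.Propositional using (Unique)
open import Data.List.Relation.Unary.Unique.Propositional.Properties using (upTo⁺)
open import Data.List.Relation.Binary.Sublist.Propositional
  using (_⊆_; []; _∷_; _∷ʳ_; ⊆-refl; ⊆-antisym; from∈; lookup; minimum)
open import Data.List.Relation.Binary.Sublist.Propositional.Properties using (All-resp-⊆; map⁺; ++⁺)
open import Data.List.Relation.Binary.Permutation.Propositional using (_↭_; ↭-refl)
open import Data.List.Relation.Binary.Permutation.Propositional.Properties using (↭-reverse)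
open import Data.Product using (Σ; ∃; _×_; _,_; proj₁; proj₂)
open import Data.Sum using (_⊎_; inj₁; inj₂)
open import Function using (id; _∘_)
open import Relation.Binary.PropositionalEquality
  using (_≡_; _≢_; refl; sym; trans; cong; cong₂; subst; ≢-sym; module ≡-Reasoning)
open import Relation.Binary.Definitions using (tri<; tri≈; tri>)
open import Relation.Nullary using (¬_; yes; no)

occ-++ : ∀ x xs ys → occ x (xs ++ ys) ≡ occ x xs + occ x ys
occ-++ x xs ys = trans (cong length (filter-++ (_≟ x) xs ys)) (length-++ (filter (_≟ x) xs))

occ-∷-≢ : ∀ {x y} ys → y ≢ x → occ x (y ∷ ys) ≡ occ x ys
occ-∷-≢ {x} ys y≢x = cong length (filter-reject (_≟ x) y≢x)

occ-∷-≡ : ∀ x ys → occ x (x ∷ ys) ≡ suc (occ x ys)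
occ-∷-≡ x ys = cong length (filter-accept (_≟ x) refl)

occ-∉ : ∀ {x} xs → All (_≢ x) xs → occ x xs ≡ 0
occ-∉ {x} xs ≢x = cong length (filter-none (_≟ x) ≢x)

occ-pos⇒∈ : ∀ {x} xs → 1 ≤ occ x xs → x ∈ xs
occ-pos⇒∈ {x} (y ∷ ys) occ≥1 with y ≟ x
... | yes refl = here refl
... | no y≢x   = there (occ-pos⇒∈ ys (subst (1 ≤_) (occ-∷-≢ ys y≢x) occ≥1))

Unique⇒occ≤1 : ∀ {x xs} → Unique xs → occ x xs ≤ 1
Unique⇒occ≤1 [] = z≤n
Unique⇒occ≤1 {x} {y ∷ ys} (y∉ys ∷ unique) with y ≟ x
... | yes refl = ≤-reflexive (trans (occ-∷-≡ x ys) (cong suc (occ-∉ ys (All.map ≢-sym y∉ys))))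
... | no y≢x   = subst (_≤ 1) (sym (occ-∷-≢ ys y≢x)) (Unique⇒occ≤1 unique)

occ≥2⇒∈ʳ : ∀ {x} xs ys → occ x xs ≤ 1 → 2 ≤ occ x (xs ++ ys) → x ∈ ys
occ≥2⇒∈ʳ {x} xs ys ≤1 ≥2 = occ-pos⇒∈ ys (s≤s⁻¹ (begin
  2                       ≤⟨ ≥2 ⟩
  occ x (xs ++ ys)        ≡⟨ occ-++ x xs ys ⟩
  occ x xs + occ x ys     ≤⟨ +-monoˡ-≤ (occ x ys) ≤1 ⟩
  suc (occ x ys)          ∎))
  where open ≤-Reasoning

occ≥2⇒∈ˡ : ∀ {x} xs ys → occ x ys ≤ 1 → 2 ≤ occ x (xs ++ ys) → x ∈ xs
occ≥2⇒∈ˡ {x} xs ys ≤1 ≥2 = occ-pos⇒∈ xs (s≤s⁻¹ (begin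
  2                       ≤⟨ ≥2 ⟩
  occ x (xs ++ ys)        ≡⟨ trans (occ-++ x xs ys) (+-comm (occ x xs) (occ x ys)) ⟩
  occ x ys + occ x xs     ≤⟨ +-monoˡ-≤ (occ x xs) ≤1 ⟩
  suc (occ x xs)          ∎))
  where open ≤-Reasoning

AllPairs-resp-⊆ : ∀ {A : Set} {R : A → A → Set} {xs ys} → xs ⊆ ys → AllPairs R ys → AllPairs R xs
AllPairs-resp-⊆ []         []         = []
AllPairs-resp-⊆ (_ ∷ʳ xs⊆) (_ ∷ rys)  = AllPairs-resp-⊆ xs⊆ rys
AllPairs-resp-⊆ (refl ∷ xs⊆) (ry ∷ rys) = All-resp-⊆ xs⊆ ry ∷ AllPairs-resp-⊆ xs⊆ rys

AllPairs-of-pairs : ∀ {A : Set} {R : A → A → Set} xs →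
                    (∀ {x y} → x ∷ y ∷ [] ⊆ xs → R x y) → AllPairs R xs
AllPairs-of-pairs []       _    = []
AllPairs-of-pairs (x ∷ xs) pair =
  All.tabulate (λ y∈xs → pair (refl ∷ from∈ y∈xs)) ∷ AllPairs-of-pairs xs (pair ∘ (x ∷ʳ_))

⊆-map⁻ : ∀ {A B : Set} (f : A → B) {ys} xs → ys ⊆ map f xs → ∃ λ zs → zs ⊆ xs × map f zs ≡ ys
⊆-map⁻ f []       []          = [] , [] , refl
⊆-map⁻ f (x ∷ xs) (_ ∷ʳ ys⊆)   with zs , zs⊆ , refl ← ⊆-map⁻ f xs ys⊆ = zs , x ∷ʳ zs⊆ , refl
⊆-map⁻ f (x ∷ xs) (refl ∷ ys⊆) with zs , zs⊆ , refl ← ⊆-map⁻ f xs ys⊆ = x ∷ zs , refl ∷ zs⊆ , refl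

++-overlap : ∀ {A : Set} (xs ys ws zs : List A) → xs ++ ys ≡ ws ++ zs →
             (∃ λ m → ys ≡ m ++ zs) ⊎ (∃ λ m → zs ≡ m ++ ys)
++-overlap []       ys ws       zs eq = inj₁ (ws , eq)
++-overlap (x ∷ xs) ys []       zs eq = inj₂ (x ∷ xs , sym eq)
++-overlap (x ∷ xs) ys (_ ∷ ws) zs eq = ++-overlap xs ys ws zs (∷-injectiveʳ eq)

∈-∷⁻ : ∀ {x y : ℕ} {ys} → x ≢ y → x ∈ y ∷ ys → x ∈ ys
∈-∷⁻ x≢y (here x≡y)  = ⊥-elim (x≢y x≡y)
∈-∷⁻ _   (there x∈ys) = x∈ys

Sorted : List ℕ → Set
Sorted = AllPairs _<_

Sorted-⊆ : ∀ {xs ys} → Sorted xs → Sorted ys → All (_∈ ys) xs → xs ⊆ ys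
Sorted-⊆ {[]}     _ _ _ = minimum _
Sorted-⊆ {x ∷ xs} {y ∷ ys} (x< ∷ sxs) (y< ∷ sys) (here refl ∷ xs∈) =
  refl ∷ Sorted-⊆ sxs sys (All.zipWith (λ (x<z , z∈) → ∈-∷⁻ (>⇒≢ x<z) z∈) (x< , xs∈))
Sorted-⊆ {x ∷ xs} {y ∷ ys} (x< ∷ sxs) (y< ∷ sys) (there x∈ys ∷ xs∈) =
  y ∷ʳ Sorted-⊆ (x< ∷ sxs) sys
         (x∈ys ∷ All.zipWith (λ (x<z , z∈) → ∈-∷⁻ (>⇒≢ (<-trans y<x x<z)) z∈) (x< , xs∈))
  where
  y<x : y < x
  y<x = All.lookup y< x∈ys

Sorted-≡ : ∀ {xs ys} → Sorted xs → Sorted ys →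
           (∀ {z} → z ∈ xs → z ∈ ys) → (∀ {z} → z ∈ ys → z ∈ xs) → xs ≡ ys
Sorted-≡ sxs sys xs⊆ ys⊆ =
  ⊆-antisym (Sorted-⊆ sxs sys (All.tabulate xs⊆)) (Sorted-⊆ sys sxs (All.tabulate ys⊆))

range-sorted : ∀ a b → Sorted (range a b)
range-sorted a b = AllPairs.map⁺ (AllPairs.applyUpTo⁺₁ id _ (λ i<j _ → +-monoʳ-< a i<j))

∈-range⁺ : ∀ {a b x} → a ≤ x → x ≤ b → x ∈ range a b
∈-range⁺ {a} {b} a≤x x≤b =
  subst (_∈ range a b) (m+[n∸m]≡n a≤x) (∈-map⁺ (a +_) (∈-upTo⁺ (∸-monoˡ-< (s≤s x≤b) a≤x)))

∈-range⁻ : ∀ {a b x} → x ∈ range a b → a ≤ x × x ≤ b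
∈-range⁻ {a} {b} x∈ with i , i∈ , refl ← ∈-map⁻ (a +_) x∈ = m≤m+n a i , s≤s⁻¹ (begin-strict
  a + i               <⟨ +-monoʳ-< a i<k ⟩
  a + (suc b ∸ a)     ≡⟨ m+[n∸m]≡n {a} (<⇒≤ a<1+b) ⟩
  suc b               ∎)
  where
  open ≤-Reasoning
  i<k : i < suc b ∸ a
  i<k = ∈-upTo⁻ i∈
  a<1+b : a < suc b
  a<1+b = m∸n≢0⇒n<m (λ k≡0 → n≮0 (subst (i <_) k≡0 i<k))

-- Junk value 0 when no letter of w is sent to y.
preimage : (ℕ → ℕ) → Seq → ℕ → ℕ
preimage f []      y = 0
preimage f (x ∷ w) y with f x ≟ y
... | yes _ = x
... | no _  = preimage f w y

preimage-inverse : ∀ f w → (∀ {x y} → x ∈ w → y ∈ w → f x ≡ f y → x ≡ y) →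
                   ∀ {x} → x ∈ w → preimage f w (f x) ≡ x
preimage-inverse f (x′ ∷ w) injective {x} x∈ with f x′ ≟ f x | x∈
... | yes fx′≡fx | _           = injective (here refl) x∈ fx′≡fx
... | no fx′≢fx  | here refl   = ⊥-elim (fx′≢fx refl)
... | no _       | there x∈w   = preimage-inverse f w (λ p q → injective (there p) (there q)) x∈w

Contains⇒renamed-⊆ : ∀ {x s} → Contains x s → ∃ λ g → map g s ⊆ x
Contains⇒renamed-⊆ {x} (w , w⊆x , f , injective , refl) =
  preimage f w , subst (_⊆ x) (sym g∘f≡id) w⊆x
  where
  g∘f≡id : map (preimage f w) (map f w) ≡ w
  g∘f≡id = trans (sym (map-∘ w)) (map-id-local (All.tabulate (preimage-inverse f w injective)))

-- A letter of a formation is tagged with the index of its block; R i is the order of block i.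
data Precedes (R : ℕ → ℕ → ℕ → Set) : ℕ × ℕ → ℕ × ℕ → Set where
  across : ∀ {i j x y} → i < j → Precedes R (i , x) (j , y)
  within : ∀ {i x y} → R i x y → Precedes R (i , x) (i , y)

data BlocksSorted (R : ℕ → ℕ → ℕ → Set) : ℕ → List Seq → Set where
  []  : ∀ {i} → BlocksSorted R i []
  _∷_ : ∀ {i p ps} → AllPairs (R i) p → BlocksSorted R (suc i) ps → BlocksSorted R i (p ∷ ps)

tagged : ℕ → List Seq → List (ℕ × ℕ)
tagged i []       = []
tagged i (p ∷ ps) = map (i ,_) p ++ tagged (suc i) ps

untag-tagged : ∀ i ps → map proj₂ (tagged i ps) ≡ concat ps
untag-tagged i []       = refl
untag-tagged i (p ∷ ps) = begin
  map proj₂ (map (i ,_) p ++ tagged (suc i) ps)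
    ≡⟨ map-++ proj₂ (map (i ,_) p) _ ⟩
  map proj₂ (map (i ,_) p) ++ map proj₂ (tagged (suc i) ps)
    ≡⟨ cong₂ _++_ (trans (sym (map-∘ p)) (map-id p)) (untag-tagged (suc i) ps) ⟩
  p ++ concat ps
    ∎
  where open ≡-Reasoning

tagged-≥ : ∀ i ps → All (λ z → i ≤ proj₁ z) (tagged i ps)
tagged-≥ i []       = []
tagged-≥ i (p ∷ ps) = All.++⁺ (All.map⁺ (All.tabulate (λ _ → ≤-refl)))
                              (All.map (≤-trans (n≤1+n i)) (tagged-≥ (suc i) ps))

tagged-< : ∀ i ps → All (λ z → proj₁ z < i + length ps) (tagged i ps)
tagged-< i []       = []
tagged-< i (p ∷ ps) =
  All.++⁺ (All.map⁺ (All.tabulate (λ _ → m<m+n i z<s)))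
          (All.map (λ {z} → subst (proj₁ z <_) (sym (+-suc i (length ps)))) (tagged-< (suc i) ps))

tagged-sorted : ∀ {R i ps} → BlocksSorted R i ps → AllPairs (Precedes R) (tagged i ps)
tagged-sorted [] = []
tagged-sorted {i = i} {p ∷ ps} (sp ∷ sps) =
  AllPairs.++⁺ (AllPairs.map⁺ (AllPairs.map within sp)) (tagged-sorted sps)
               (All.map⁺ (All.tabulate (λ _ → All.map across (tagged-≥ (suc i) ps))))

Occurs : (ℕ → ℕ → ℕ → Set) → ℕ → Seq → Set
Occurs R k s = ∃ λ (g : ℕ → ℕ) → ∃ λ Z →
  AllPairs (Precedes R) Z × All (λ z → proj₁ z < k) Z × map proj₂ Z ≡ map g s

occurs-in-formation : ∀ {R ps s} → BlocksSorted R 0 ps → Contains (concat ps) s → Occurs R (length ps) s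
occurs-in-formation {ps = ps} sorted contains
  with g , gs⊆ ← Contains⇒renamed-⊆ contains
  with Z , Z⊆ , eq ← ⊆-map⁻ proj₂ (tagged 0 ps) (subst (_ ⊆_) (sym (untag-tagged 0 ps)) gs⊆)
  = g , Z , AllPairs-resp-⊆ Z⊆ (tagged-sorted sorted) , All-resp-⊆ Z⊆ (tagged-< 0 ps) , eq

Occurs-⊆ : ∀ {R k s t} → s ⊆ t → Occurs R k t → Occurs R k s
Occurs-⊆ s⊆t (g , Z , sorted , bounded , eq)
  with Z′ , Z′⊆ , eq′ ← ⊆-map⁻ proj₂ Z (subst (_ ⊆_) (sym eq) (map⁺ g s⊆t))
  = g , Z′ , AllPairs-resp-⊆ Z′⊆ sorted , All-resp-⊆ Z′⊆ bounded , eq′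

Ascending : ℕ → ℕ → ℕ → Set
Ascending _ = _<_

ThirdDescending : ℕ → ℕ → ℕ → Set
ThirdDescending 2 x y = y < x
ThirdDescending _ x y = x < y

upTo-sorted : ∀ r → Sorted (upTo r)
upTo-sorted r = AllPairs.applyUpTo⁺₁ id r (λ i<j _ → i<j)

downFrom-sorted : ∀ r → AllPairs (λ x y → y < x) (downFrom r)
downFrom-sorted r = AllPairs.applyDownFrom⁺₁ id r (λ j<i _ → j<i)

ascending⁴ : ℕ → List Seq
ascending⁴ r = upTo r ∷ upTo r ∷ upTo r ∷ upTo r ∷ []

thirdReversed : ℕ → List Seq
thirdReversed r = upTo r ∷ upTo r ∷ downFrom r ∷ upTo r ∷ []

ascending⁴-formation : ∀ r → IsFormation r 4 (concat (ascending⁴ r))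
ascending⁴-formation r =
  upTo r , upTo⁺ r , length-upTo r ,
  ascending⁴ r , refl , ↭-refl ∷ ↭-refl ∷ ↭-refl ∷ ↭-refl ∷ [] , refl

thirdReversed-formation : ∀ r → IsFormation r 4 (concat (thirdReversed r))
thirdReversed-formation r =
  upTo r , upTo⁺ r , length-upTo r ,
  thirdReversed r , refl , ↭-refl ∷ ↭-refl ∷ downFrom↭upTo ∷ ↭-refl ∷ [] , refl
  where
  downFrom↭upTo : downFrom r ↭ upTo r
  downFrom↭upTo = subst (_↭ upTo r) (reverse-upTo r) (↭-reverse (upTo r))

occurrences : ∀ {s} → FWWitness s 4 → Occurs Ascending 4 s × Occurs ThirdDescending 4 s
occurrences (r , contains) =
  occurs-in-formation (up ∷ up ∷ up ∷ up ∷ []) (contains _ (ascending⁴-formation r)) ,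
  occurs-in-formation (up ∷ up ∷ downFrom-sorted r ∷ up ∷ []) (contains _ (thirdReversed-formation r))
  where
  up : Sorted (upTo r)
  up = upTo-sorted r

Precedes⇒≤ : ∀ {R i j x y} → Precedes R (i , x) (j , y) → i ≤ j
Precedes⇒≤ (across i<j) = <⇒≤ i<j
Precedes⇒≤ (within _)   = ≤-refl

Precedes⇒within : ∀ {R i j x y} → Precedes R (i , x) (j , y) → j ≤ i → R i x y
Precedes⇒within (across i<j) j≤i = ⊥-elim (<⇒≱ i<j j≤i)
Precedes⇒within (within r)   _   = r

repeat⇒across : ∀ {R i j x} → (∀ {k} → ¬ R k x x) → Precedes R (i , x) (j , x) → i < j
repeat⇒across _      (across i<j) = i<j
repeat⇒across irrefl (within r)   = ⊥-elim (irrefl r)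

m<n<2+m⇒n≡1+m : ∀ {m n} → m < n → n < 2 + m → n ≡ suc m
m<n<2+m⇒n≡1+m m<n n<2+m = ≤-antisym (s≤s⁻¹ n<2+m) m<n

consecutive : ∀ {i j k} → i < j → j < k → k < 3 + i → j ≡ suc i × k ≡ suc j
consecutive i<j j<k k<3+i with refl ← m<n<2+m⇒n≡1+m i<j (<-≤-trans j<k (s≤s⁻¹ k<3+i)) =
  refl , m<n<2+m⇒n≡1+m j<k k<3+i

squeezed : ∀ {j x y} → j ≤ x → x < y → y ≤ suc j → x ≡ j × y ≡ suc j
squeezed j≤x x<y y≤1+j with refl ← ≤-antisym (s≤s⁻¹ (<-≤-trans x<y y≤1+j)) j≤x =
  refl , ≤-antisym y≤1+j x<y

repeat : ∀ {i j x} → Precedes Ascending (i , x) (j , x) → i < j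
repeat = repeat⇒across (<-irrefl refl)

-- In an ascending formation a frame a b … b a leaves room for at most three blocks of b's.
frame : ∀ {i₀ i₁ j k a b} → Precedes Ascending (i₀ , a) (i₁ , b) → Precedes Ascending (j , b) (k , a) →
        k < 4 → j < 3 + i₁
frame (within a<b)   (within b<a)  _   = ⊥-elim (<-asym a<b b<a)
frame (across i₀<i₁) ba            k<4 = ≤-trans (s≤s (≤-trans (Precedes⇒≤ ba) (s≤s⁻¹ k<4)))
                                                 (+-monoʳ-≤ 3 (≤-trans (s≤s z≤n) i₀<i₁))
frame (within _)     (across j<k)  k<4 = ≤-trans (<-≤-trans j<k (s≤s⁻¹ k<4)) (m≤m+n 3 _)

shift : ∀ {i j k b x} → Precedes Ascending (i , b) (j , x) → Precedes Ascending (k , x) (suc (suc i) , b) →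
        j < k → k ≡ suc j
shift (within b<x)  (within x<b)   _   = ⊥-elim (<-asym b<x x<b)
shift (within _)    (across k<2+i) i<k = m<n<2+m⇒n≡1+m i<k k<2+i
shift (across i<j)  (within _)     j<k = cong suc (sym (m<n<2+m⇒n≡1+m i<j j<k))
shift (across i<j)  (across k<2+i) j<k = ⊥-elim (<⇒≱ k<2+i (≤-trans (s≤s i<j) j<k))

ascending-avoids-abbbba : ∀ {a b} → ¬ Occurs Ascending 4 (a ∷ b ∷ b ∷ b ∷ b ∷ a ∷ [])
ascending-avoids-abbbba (_ , _ ∷ _ ∷ _ ∷ _ ∷ _ ∷ _ ∷ [] ,
    (p₀₁ ∷ _) ∷ (p₁₂ ∷ _) ∷ (p₂₃ ∷ _) ∷ (p₃₄ ∷ _) ∷ (p₄₅ ∷ _) ∷ _ ,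
    (_ ∷ _ ∷ _ ∷ _ ∷ _ ∷ i₅<4 ∷ []) , refl) =
  <⇒≱ (frame p₀₁ p₄₅ i₅<4) (≤-trans (s≤s (≤-trans (s≤s (repeat p₁₂)) (repeat p₂₃))) (repeat p₃₄))

ascending-avoids-abbccba : ∀ {a b c} → ¬ Occurs Ascending 4 (a ∷ b ∷ b ∷ c ∷ c ∷ b ∷ a ∷ [])
ascending-avoids-abbccba (_ , _ ∷ _ ∷ _ ∷ _ ∷ _ ∷ _ ∷ _ ∷ [] ,
    (p₀₁ ∷ _) ∷ (p₁₂ ∷ _) ∷ (p₂₃ ∷ _ ∷ p₂₅ ∷ _) ∷ (p₃₄ ∷ _) ∷ (p₄₅ ∷ _) ∷ (p₅₆ ∷ _) ∷ _ ,
    (_ ∷ _ ∷ _ ∷ _ ∷ _ ∷ _ ∷ i₆<4 ∷ []) , refl)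
  with refl , refl ← consecutive (repeat p₁₂) (repeat p₂₅) (frame p₀₁ p₅₆ i₆<4)
  with refl , refl ← squeezed (Precedes⇒≤ p₂₃) (repeat p₃₄) (Precedes⇒≤ p₄₅)
  = <-asym (Precedes⇒within p₂₃ ≤-refl) (Precedes⇒within p₄₅ ≤-refl)

ascending-avoids-abdcbcdba : ∀ {a b c d} → ¬ Occurs Ascending 4 (a ∷ b ∷ d ∷ c ∷ b ∷ c ∷ d ∷ b ∷ a ∷ [])
ascending-avoids-abdcbcdba (_ , _ ∷ _ ∷ _ ∷ _ ∷ _ ∷ _ ∷ _ ∷ _ ∷ _ ∷ [] ,
    (p₀₁ ∷ _) ∷ (p₁₂ ∷ p₁₃ ∷ p₁₄ ∷ _) ∷ (p₂₃ ∷ _ ∷ _ ∷ p₂₆ ∷ _) ∷ (_ ∷ p₃₅ ∷ _) ∷ (_ ∷ _ ∷ p₄₇ ∷ _) ∷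
      (p₅₆ ∷ p₅₇ ∷ _) ∷ (p₆₇ ∷ _) ∷ (p₇₈ ∷ _) ∷ _ ,
    (_ ∷ _ ∷ _ ∷ _ ∷ _ ∷ _ ∷ _ ∷ _ ∷ i₈<4 ∷ []) , refl)
  with refl , refl ← consecutive (repeat p₁₄) (repeat p₄₇) (frame p₀₁ p₇₈ i₈<4)
  with refl ← shift p₁₂ p₆₇ (repeat p₂₆) | refl ← shift p₁₃ p₅₇ (repeat p₃₅)
  = <-asym (Precedes⇒within p₂₃ (s≤s⁻¹ (Precedes⇒≤ p₅₆)))
           (Precedes⇒within p₅₆ (s≤s (Precedes⇒≤ p₂₃)))

ThirdDescending-irrefl : ∀ {i x} → ¬ ThirdDescending i x x
ThirdDescending-irrefl {0}                 = <-irrefl refl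
ThirdDescending-irrefl {1}                 = <-irrefl refl
ThirdDescending-irrefl {2}                 = <-irrefl refl
ThirdDescending-irrefl {suc (suc (suc _))} = <-irrefl refl

ThirdDescending-≢2 : ∀ {i x y} → i ≢ 2 → ThirdDescending i x y → x < y
ThirdDescending-≢2 {0}                 _   r = r
ThirdDescending-≢2 {1}                 _   r = r
ThirdDescending-≢2 {2}                 2≢2 _ = ⊥-elim (2≢2 refl)
ThirdDescending-≢2 {suc (suc (suc _))} _   r = r

ThirdDescending-≡2 : ∀ {i x y} → i ≡ 2 → ThirdDescending i x y → y < x
ThirdDescending-≡2 refl r = r

≥3⇒≢2 : ∀ {i} → 3 ≤ i → i ≢ 2
≥3⇒≢2 3≤i refl = 1+n≰n 3≤i

last-ba : ∀ {i j a b} → 3 ≤ i → j ≤ 3 → Precedes ThirdDescending (i , b) (j , a) → b < a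
last-ba 3≤i j≤3 p = ThirdDescending-≢2 (≥3⇒≢2 3≤i) (Precedes⇒within p (≤-trans j≤3 3≤i))

later-ba : ∀ {i₂ i₃ i₄ i₅ a b} →
  1 ≤ i₂ → Precedes ThirdDescending (i₂ , b) (i₃ , a) → i₂ < i₄ → Precedes ThirdDescending (i₃ , a) (i₄ , b) →
  i₃ < i₅ → Precedes ThirdDescending (i₄ , b) (i₅ , a) → i₅ ≤ 3 → b < a
later-ba {i₂ = i₂} _ (within r₂₃) i₂<i₄ _ _ p₄₅ i₅≤3 with i₂ ≟ 2
... | no i₂≢2  = ThirdDescending-≢2 i₂≢2 r₂₃
... | yes refl = last-ba i₂<i₄ i₅≤3 p₄₅
later-ba 1≤i₂ (across i₂<i₃) _ (within r₃₄) i₃<i₅ _ i₅≤3 =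
  ThirdDescending-≡2 (≤-antisym (s≤s⁻¹ (<-≤-trans i₃<i₅ i₅≤3)) (≤-trans (s≤s 1≤i₂) i₂<i₃)) r₃₄
later-ba 1≤i₂ (across i₂<i₃) _ (across i₃<i₄) _ p₄₅ i₅≤3 =
  last-ba (≤-trans (s≤s (≤-trans (s≤s 1≤i₂) i₂<i₃)) i₃<i₄) i₅≤3 p₄₅

abbaba-blocks : ∀ {i₀ i₁ i₂ i₃ i₄ i₅ a b} →
  Precedes ThirdDescending (i₀ , a) (i₁ , b) → i₁ < i₂ → Precedes ThirdDescending (i₂ , b) (i₃ , a) →
  i₂ < i₄ → Precedes ThirdDescending (i₃ , a) (i₄ , b) → i₃ < i₅ → Precedes ThirdDescending (i₄ , b) (i₅ , a) →
  i₅ ≤ 3 → ⊥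
abbaba-blocks {i₂ = i₂} {i₃} (across i₀<i₁) i₁<i₂ p₂₃ i₂<i₄ _ i₃<i₅ p₄₅ i₅≤3 =
  <-asym (ThirdDescending-≡2 i₂≡2 (Precedes⇒within p₂₃ (≤-trans i₃≤2 2≤i₂)))
         (last-ba (≤-trans (s≤s 2≤i₂) i₂<i₄) i₅≤3 p₄₅)
  where
  2≤i₂ : 2 ≤ i₂
  2≤i₂ = ≤-trans (s≤s (≤-trans (s≤s z≤n) i₀<i₁)) i₁<i₂
  i₂≡2 : i₂ ≡ 2
  i₂≡2 = ≤-antisym (s≤s⁻¹ (<-≤-trans i₂<i₄ (≤-trans (Precedes⇒≤ p₄₅) i₅≤3))) 2≤i₂
  i₃≤2 : i₃ ≤ 2
  i₃≤2 = s≤s⁻¹ (<-≤-trans i₃<i₅ i₅≤3)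
abbaba-blocks {i₁ = i₁} (within r₀₁) i₁<i₂ p₂₃ i₂<i₄ p₃₄ i₃<i₅ p₄₅ i₅≤3 =
  <-asym (ThirdDescending-≢2 i₁≢2 r₀₁)
         (later-ba (≤-trans (s≤s z≤n) i₁<i₂) p₂₃ i₂<i₄ p₃₄ i₃<i₅ p₄₅ i₅≤3)
  where
  i₁≢2 : i₁ ≢ 2
  i₁≢2 refl = <⇒≱ (≤-trans (s≤s i₁<i₂) i₂<i₄) (≤-trans (Precedes⇒≤ p₄₅) i₅≤3)

thirdDescending-avoids-abbaba : ∀ {a b} → ¬ Occurs ThirdDescending 4 (a ∷ b ∷ b ∷ a ∷ b ∷ a ∷ [])
thirdDescending-avoids-abbaba (_ , _ ∷ _ ∷ _ ∷ _ ∷ _ ∷ _ ∷ [] ,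
    (p₀₁ ∷ _) ∷ (p₁₂ ∷ _) ∷ (p₂₃ ∷ p₂₄ ∷ _) ∷ (p₃₄ ∷ p₃₅ ∷ _) ∷ (p₄₅ ∷ _) ∷ _ ,
    (_ ∷ _ ∷ _ ∷ _ ∷ _ ∷ i₅<4 ∷ []) , refl) =
  abbaba-blocks p₀₁ (rep p₁₂) p₂₃ (rep p₂₄) p₃₄ (rep p₃₅) p₄₅ (s≤s⁻¹ i₅<4)
  where
  rep : ∀ {i j x} → Precedes ThirdDescending (i , x) (j , x) → i < j
  rep = repeat⇒across ThirdDescending-irrefl

occ-range≤1 : ∀ x a b → occ x (range a b) ≤ 1
occ-range≤1 x a b = Unique⇒occ≤1 (AllPairs.map <⇒≢ (range-sorted a b))

⊆-range : ∀ {a b xs} → Sorted xs → All (λ x → a ≤ x × x ≤ b) xs → xs ⊆ range a b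
⊆-range sorted bounds =
  Sorted-⊆ sorted (range-sorted _ _) (All.map (λ (a≤x , x≤b) → ∈-range⁺ a≤x x≤b) bounds)

framed : ℕ → Seq → Seq
framed n mid = range 1 n ++ 2 ∷ mid ++ 2 ∷ 1 ∷ []

framed-⊆ : ∀ {n mid ps ms} → ps ⊆ range 1 n → ms ⊆ mid → ps ++ 2 ∷ ms ++ 2 ∷ 1 ∷ [] ⊆ framed n mid
framed-⊆ ps⊆ ms⊆ = ++⁺ ps⊆ (refl ∷ ++⁺ ms⊆ ⊆-refl)

frame-tail : ∀ p v w → p ++ 2 ∷ v ≡ w ++ 2 ∷ 1 ∷ [] → v ≡ 1 ∷ [] ⊎ ∃ λ mid → v ≡ mid ++ 2 ∷ 1 ∷ []
frame-tail p v w eq with ++-overlap p (2 ∷ v) w (2 ∷ 1 ∷ []) eq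
... | inj₁ ([] , refl)          = inj₁ refl
... | inj₁ (_ ∷ mid , refl)     = inj₂ (mid , refl)
... | inj₂ ([] , refl)          = inj₁ refl
... | inj₂ (_ ∷ [] , ())
... | inj₂ (_ ∷ _ ∷ [] , ())
... | inj₂ (_ ∷ _ ∷ _ ∷ _ , ())

short-frame-impossible : ∀ {n} → 3 ≤ n →
  ¬ (∀ {x} → x ∈ range 1 n ++ 2 ∷ 1 ∷ [] → 2 ≤ occ x (range 1 n ++ 2 ∷ 1 ∷ []))
short-frame-impossible {n} 3≤n twice
  with occ≥2⇒∈ʳ (range 1 n) (2 ∷ 1 ∷ []) (occ-range≤1 3 1 n) (twice (∈-++⁺ˡ (∈-range⁺ (s≤s z≤n) 3≤n)))
... | here ()
... | there (here ())

module Middle {n mid} (2≤n : 2 ≤ n)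
  (twice : ∀ {x} → x ∈ framed n mid → 2 ≤ occ x (framed n mid))
  (ascending : Occurs Ascending 4 (framed n mid))
  (descending : Occurs ThirdDescending 4 (framed n mid)) where

  ⊆-prefix : ∀ {ys} → Sorted ys → All (λ y → 3 ≤ y × y ≤ n) ys → 1 ∷ 2 ∷ ys ⊆ range 1 n
  ⊆-prefix sorted bounds = ⊆-range
    ((s≤s (s≤s z≤n) ∷ All.map (<⇒≤ ∘ proj₁) bounds) ∷ All.map proj₁ bounds ∷ sorted)
    ((≤-refl , ≤-trans (s≤s z≤n) 2≤n) ∷ (s≤s z≤n , 2≤n) ∷
      All.map (λ (3≤y , y≤n) → ≤-trans (s≤s z≤n) 3≤y , y≤n) bounds)

  12⊆prefix : 1 ∷ 2 ∷ [] ⊆ range 1 n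
  12⊆prefix = ⊆-prefix [] []

  2∉mid : 2 ∉ mid
  2∉mid 2∈ = ascending-avoids-abbbba (Occurs-⊆ (framed-⊆ 12⊆prefix (from∈ 2∈)) ascending)

  1∉mid : 1 ∉ mid
  1∉mid 1∈ = thirdDescending-avoids-abbaba (Occurs-⊆ (framed-⊆ 12⊆prefix (from∈ 1∈)) descending)

  mid-pair-≢ : ∀ {x y} → x ∷ y ∷ [] ⊆ mid → x ≢ y
  mid-pair-≢ xy⊆ refl = ascending-avoids-abbccba (Occurs-⊆ (framed-⊆ 12⊆prefix xy⊆) ascending)

  mid-unique : Unique mid
  mid-unique = AllPairs-of-pairs mid mid-pair-≢

  occ-tail≤1 : ∀ {y} → y ∈ mid → occ y (2 ∷ mid ++ 2 ∷ 1 ∷ []) ≤ 1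
  occ-tail≤1 {y} y∈mid = begin
    occ y (2 ∷ mid ++ 2 ∷ 1 ∷ [])   ≡⟨ occ-∷-≢ _ 2≢y ⟩
    occ y (mid ++ 2 ∷ 1 ∷ [])       ≡⟨ occ-++ y mid _ ⟩
    occ y mid + occ y (2 ∷ 1 ∷ [])  ≡⟨ cong (occ y mid +_) (occ-∉ _ (2≢y ∷ 1≢y ∷ [])) ⟩
    occ y mid + 0                   ≡⟨ +-identityʳ _ ⟩
    occ y mid                       ≤⟨ Unique⇒occ≤1 mid-unique ⟩
    1                               ∎
    where
    open ≤-Reasoning
    1≢y : 1 ≢ y
    1≢y refl = 1∉mid y∈mid
    2≢y : 2 ≢ y
    2≢y refl = 2∉mid y∈mid

  mid-bounds : ∀ {y} → y ∈ mid → 3 ≤ y × y ≤ n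
  mid-bounds {y} y∈mid =
    ≤∧≢⇒< (≤∧≢⇒< 1≤y (λ { refl → 1∉mid y∈mid })) (λ { refl → 2∉mid y∈mid }) , y≤n
    where
    in-prefix : y ∈ range 1 n
    in-prefix = occ≥2⇒∈ˡ (range 1 n) _ (occ-tail≤1 y∈mid)
                  (twice (∈-++⁺ʳ (range 1 n) (there (∈-++⁺ˡ y∈mid))))
    1≤y : 1 ≤ y
    1≤y = proj₁ (∈-range⁻ in-prefix)
    y≤n : y ≤ n
    y≤n = proj₂ (∈-range⁻ in-prefix)

  range-in-mid : ∀ {x} → 3 ≤ x → x ≤ n → x ∈ mid
  range-in-mid {x} 3≤x x≤n
    with occ≥2⇒∈ʳ (range 1 n) _ (occ-range≤1 x 1 n) (twice (∈-++⁺ˡ (∈-range⁺ (≤-trans (s≤s z≤n) 3≤x) x≤n)))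
  ... | here refl = ⊥-elim (1+n≰n 3≤x)
  ... | there x∈ with ∈-++⁻ mid x∈
  ...   | inj₁ x∈mid             = x∈mid
  ...   | inj₂ (here refl)       = ⊥-elim (1+n≰n 3≤x)
  ...   | inj₂ (there (here refl)) = ⊥-elim (1+n≰n (≤-trans (s≤s (s≤s z≤n)) 3≤x))

  mid-sorted : Sorted mid
  mid-sorted = AllPairs-of-pairs mid ordered
    where
    ordered : ∀ {x y} → x ∷ y ∷ [] ⊆ mid → x < y
    ordered {x} {y} xy⊆ with <-cmp x y
    ... | tri< x<y _ _ = x<y
    ... | tri≈ _ x≡y _ = ⊥-elim (mid-pair-≢ xy⊆ x≡y)
    ... | tri> _ _ y<x = ⊥-elim (ascending-avoids-abdcbcdba (Occurs-⊆ (framed-⊆ 12yx⊆prefix xy⊆) ascending))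
      where
      12yx⊆prefix : 1 ∷ 2 ∷ y ∷ x ∷ [] ⊆ range 1 n
      12yx⊆prefix = ⊆-prefix ((y<x ∷ []) ∷ [] ∷ [])
        (mid-bounds (lookup xy⊆ (there (here refl))) ∷ mid-bounds (lookup xy⊆ (here refl)) ∷ [])

  2∷mid≡range : 2 ∷ mid ≡ range 2 n
  2∷mid≡range = Sorted-≡ (All.tabulate (proj₁ ∘ mid-bounds) ∷ mid-sorted) (range-sorted 2 n) to from
    where
    to : ∀ {z} → z ∈ 2 ∷ mid → z ∈ range 2 n
    to (here refl) = ∈-range⁺ ≤-refl 2≤n
    to (there z∈mid) = ∈-range⁺ (<⇒≤ (proj₁ (mid-bounds z∈mid))) (proj₂ (mid-bounds z∈mid))
    from : ∀ {z} → z ∈ range 2 n → z ∈ 2 ∷ mid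
    from z∈ with m≤n⇒m<n∨m≡n (proj₁ (∈-range⁻ {2} {n} z∈))
    ... | inj₁ 2<z  = there (range-in-mid 2<z (proj₂ (∈-range⁻ {2} {n} z∈)))
    ... | inj₂ refl = here refl

lemma18 : (n : ℕ) → 6 ≤ n → (u : Seq) →
    numLetters u ≡ n →
    (∀ {x} → x ∈ u → 2 ≤ occ x u) →
    FW≡ u 4 →
    AltLength5 u →
    take n u ≡ range 1 n →
    MiddleIs n u 2 →
    (Σ Seq λ w → u ≡ w ++ 2 ∷ 1 ∷ []) →
    u ≡ range 1 n ++ range 2 n ++ 2 ∷ 1 ∷ []
lemma18 n 6≤n u _ twice (witness , _) _ prefix (v , middle) (w , suffix)
  with refl ← trans (sym (take++drop≡id n u)) (cong₂ _++_ prefix middle)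
  with frame-tail (range 1 n) v w suffix
... | inj₁ refl = ⊥-elim (short-frame-impossible (≤-trans (s≤s (s≤s (s≤s z≤n))) 6≤n) twice)
... | inj₂ (mid , refl) with ascending , descending ← occurrences witness =
  cong (λ m → range 1 n ++ m ++ 2 ∷ 1 ∷ [])
       (Middle.2∷mid≡range (≤-trans (s≤s (s≤s z≤n)) 6≤n) twice ascending descending)
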